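{- Let $G$ be a finite group. Then the undirected power graph $\mathcal{P}(G)$ is (isomorphic to) an undirected Cayley graph of some group if and only if $G$ is a cyclic $p$-group for some prime $p$.
   Context: For a finite group $G$, the undirected power graph $\mathcal{P}(G)$ is the simple graph with vertex set $G$ in which two distinct vertices $x,y$ are adjacent if and only if one of them is a positive integer power of the other. For a group $H$ and an inverse-closed subset $C\subseteq H\setminus\{e\}$, the undirected Cayley graph $X(H,C)$ has vertex set $H$, with distinct $g,h$ adjacent if and only if $g^{ -1}h\in C$. A cyclic $p$-group is a cyclic group whose order is a power of a prime $p$. -}

module Defs where

open import Level using (Level; _⊔_)
open import Algebra.Bundles using (Group)
open import Data.Nat using (ℕ; _≥_; _^_)
open import Data.Nat.Primality using (Prime)
open import Data.Fin using (Fin)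
open import Data.Product using (Σ; ∃; _×_; _,_)
open import Data.Sum using (_⊎_)
open import Relation.Nullary using (¬_)
open import Relation.Binary.PropositionalEquality using (_≡_)
import Algebra.Definitions.RawMonoid as RawMonoidDefs

private
  variable
    c ℓ c′ ℓ′ : Level

-- Positive-integer (in fact natural-number) powers in a group:
-- pow G k x = x ^ k, via the library's monoid "multiple" (k × x, written
-- multiplicatively): 0 × x = ε, suc k × x = x ∙ (k × x).
module _ (G : Group c ℓ) where
  open Group G
  open RawMonoidDefs rawMonoid using () renaming (_×_ to _·pow_)

  pow : ℕ → Carrier → Carrier
  pow k x = k ·pow x

  record HasOrder (n : ℕ) : Set (c ⊔ ℓ) where
    field
      enum      : Fin n → Carrier
      enum-inj  : ∀ i j → enum i ≈ enum j → i ≡ j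
      enum-surj : ∀ x → ∃ λ i → x ≈ enum i

  PowerAdj : Carrier → Carrier → Set ℓ
  PowerAdj x y = ¬ (x ≈ y) ×
    ((∃ λ k → k ≥ 1 × y ≈ pow k x) ⊎ (∃ λ k → k ≥ 1 × x ≈ pow k y))

  IsCyclic : Set (c ⊔ ℓ)
  IsCyclic = ∃ λ g → ∀ x → ∃ λ k → x ≈ pow k g

  record CayleySet {ℓc : Level} (C : Carrier → Set ℓc) : Set (c ⊔ ℓ ⊔ ℓc) where
    field
      respects : ∀ {x y} → x ≈ y → C x → C y
      inv-closed : ∀ {x} → C x → C (x ⁻¹)
      no-identity : ¬ C ε

  CayleyAdj : {ℓc : Level} → (Carrier → Set ℓc) → Carrier → Carrier → Set (ℓ ⊔ ℓc)
  CayleyAdj C g h = ¬ (g ≈ h) × C (g ⁻¹ ∙ h)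

record GraphIso {a b ℓa ℓb r s : Level}
  {A : Set a} (_≈A_ : A → A → Set ℓa) (R : A → A → Set r)
  {B : Set b} (_≈B_ : B → B → Set ℓb) (S : B → B → Set s)
  : Set (a ⊔ b ⊔ ℓa ⊔ ℓb ⊔ r ⊔ s) where
  field
    f      : A → B
    f-cong : ∀ {x y} → x ≈A y → f x ≈B f y
    f-inj  : ∀ {x y} → f x ≈B f y → x ≈A y
    f-surj : ∀ y → ∃ λ x → y ≈B f x
    adj-to   : ∀ {x y} → R x y → S (f x) (f y)
    adj-from : ∀ {x y} → S (f x) (f y) → R x y

PowerGraphIsCayley : Group c ℓ → Set _
PowerGraphIsCayley {c} {ℓ} G =
  Σ (Group c ℓ) λ H →
  Σ (Group.Carrier H → Set ℓ) λ C →
  CayleySet H C ×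
  GraphIso (Group._≈_ G) (PowerAdj G) (Group._≈_ H) (CayleyAdj H C)

IsCyclicPGroup : (G : Group c ℓ) (n : ℕ) → Set _
IsCyclicPGroup G n =
  (∃ λ p → Prime p × ∃ λ k → n ≡ p ^ k) × IsCyclic G

-- In a finite group the identity is a power of every element, so it is adjacent to every
-- other vertex of P(G). Left translations are automorphisms of a Cayley graph X(H, C), so if
-- one vertex is adjacent to all others then C = H ∖ {e} and X(H, C) is complete. Hence P(G)
-- is a Cayley graph exactly when it is complete (a complete P(G) is X(G, G ∖ {e})).
-- A complete power graph is cyclic: of any two elements one generates the other. For a
-- generator g of order n and a divisor a of n, g ^ b is a power of g ^ a only if a ∣ b, so
-- completeness makes the divisors of n a chain, i.e. n is a prime power. Conversely, by
-- Bézout g ^ b is a positive power of g ^ a as soon as gcd(a, n) ∣ b, and for n a prime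
-- power gcd(a, n) and gcd(b, n) are comparable.

module Submission where

open import Defs
open import Level using (Level; _⊔_)
open import Algebra.Bundles using (Group)
open import Data.Nat using (ℕ; zero; suc; _+_; _*_; _∸_; _≤_; _<_; _≥_; z≤n; s≤s⁻¹; NonZero; >-nonZero)
open import Data.Nat.Properties using (<⇒≱; n<1+n; ≤-trans; m∸n+n≡m; *-comm; ≤-antisym; <-cmp; m<n⇒0<n∸m; m∸n≤m; ≤-<-trans; <⇒≤)
open import Data.Nat.Divisibility
open import Data.Nat.DivMod
open import Data.Nat.GCD using (gcd; gcd[m,n]∣m; gcd[m,n]∣n)
open import Data.Nat.Primality using (Prime)
open import Data.Fin as Fin using (Fin; toℕ; fromℕ<)
open import Data.Fin.Properties using (pigeonhole; injective⇒≤; fromℕ<-injective; toℕ<n)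
open import Data.Product using (∃; _×_; _,_; proj₁; proj₂)
open import Data.Sum using (_⊎_; inj₁; inj₂)
open import Data.Empty using (⊥-elim)
open import Relation.Nullary using (¬_; yes; no)
open import Relation.Binary.Structures using (IsEquivalence)
open import Relation.Binary.Definitions using (Decidable; tri<; tri≈; tri>)
open import Relation.Binary.PropositionalEquality as ≡ using (_≡_)

-- A separate module, so that ℕ's _^_ stays out of scope of the group power _^_ below.
module Arithmetic where
  open import Data.Nat using (_^_; >-nonZero⁻¹)
  open import Data.Nat.Properties using (*-assoc; *-distribˡ-+; m≤n+m; ≤-total; ^-distribˡ-+-*)
  open import Data.Nat.GCD using (gcd-GCD; module Bézout)
  open import Data.Nat.Coprimality using (Coprime; coprime-divisor)
  open import Data.Nat.Primality using (prime⇒irreducible; ¬prime[1]; prime⇒nonZero; prime[2])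
  open import Data.Nat.Primality.Factorisation using (factorise)
  open import Data.Nat.ListAction using (product)
  open import Data.Nat.ListAction.Properties using (∈⇒∣product)
  open import Data.Nat.Tactic.RingSolver using (solve-∀)
  open import Data.List using (List; []; _∷_; length)
  open import Data.List.Relation.Unary.All as All using (All; []; _∷_)
  open import Data.List.Membership.Propositional using (_∈_)
  open import Data.List.Relation.Unary.Any using (here)
  open import Relation.Binary.PropositionalEquality using (refl; sym; trans; cong; subst; module ≡-Reasoning)

  private
    variable
      a b d n p q t : ℕ

  ∣-resp-%≡ : .{{_ : NonZero n}} → d ∣ n → a % n ≡ b % n → d ∣ a → d ∣ b
  ∣-resp-%≡ d∣n eq d∣a = ∣n∣m%n⇒∣m d∣n (subst (_ ∣_) eq (%-presˡ-∣ d∣a d∣n))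

  *-congʳ-%≡ : .{{_ : NonZero n}} → a % n ≡ b % n → (a * t) % n ≡ (b * t) % n
  *-congʳ-%≡ {n} {a} {b} {t} eq = begin
    (a * t) % n               ≡⟨ %-distribˡ-* a t n ⟩
    ((a % n) * (t % n)) % n   ≡⟨ cong (λ r → (r * (t % n)) % n) eq ⟩
    ((b % n) * (t % n)) % n   ≡⟨ %-distribˡ-* b t n ⟨
    (b * t) % n               ∎
    where open ≡-Reasoning

  bézout⇒%-inverse : .{{_ : NonZero n}} → Bézout.Identity d a n → ∃ λ k → (a * k) % n ≡ d % n
  bézout⇒%-inverse {n} {d} {a} (Bézout.+- x y eq) = x , (begin
    (a * x) % n      ≡⟨ cong (_% n) (trans (*-comm a x) (sym eq)) ⟩
    (d + y * n) % n  ≡⟨ [m+kn]%n≡m%n d y n ⟩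
    d % n            ∎)
    where open ≡-Reasoning
  -- Here a * x ≡ −d modulo n, and n′ ≡ −1 modulo n = 1 + n′.
  bézout⇒%-inverse {n@(suc n′)} {d} {a} (Bézout.-+ x y eq) = x * n′ , (begin
    (a * (x * n′)) % n          ≡⟨ [m+kn]%n≡m%n (a * (x * n′)) y n ⟨
    (a * (x * n′) + y * n) % n  ≡⟨ cong (λ r → (a * (x * n′) + r) % n) eq ⟨
    (a * (x * n′) + (d + x * a)) % n ≡⟨ cong (_% n) (regroup a x n′ d) ⟩
    (d + (a * x) * n) % n       ≡⟨ [m+kn]%n≡m%n d (a * x) n ⟩
    d % n                       ∎)
    where
    open ≡-Reasoning
    regroup : ∀ a x n′ d → a * (x * n′) + (d + x * a) ≡ d + (a * x) * suc n′
    regroup = solve-∀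

  gcd∣⇒%-solvable : .{{_ : NonZero n}} → gcd a n ∣ b → ∃ λ k → k ≥ 1 × (a * k) % n ≡ b % n
  -- Adding n to the solution k * t keeps its residue and makes it positive.
  gcd∣⇒%-solvable {n} {a} (divides t refl)
    with k , ak≡g ← bézout⇒%-inverse (Bézout.identity (gcd-GCD a n)) =
    k * t + n , ≤-trans (>-nonZero⁻¹ n) (m≤n+m n (k * t)) , (begin
      (a * (k * t + n)) % n  ≡⟨ cong (_% n) (*-distribˡ-+ a (k * t) n) ⟩
      (a * (k * t) + a * n) % n ≡⟨ %-remove-+ʳ (a * (k * t)) (n∣m*n a) ⟩
      (a * (k * t)) % n      ≡⟨ cong (_% n) (*-assoc a k t) ⟨
      (a * k * t) % n        ≡⟨ *-congʳ-%≡ ak≡g ⟩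
      (gcd a n * t) % n      ≡⟨ cong (_% n) (*-comm (gcd a n) t) ⟩
      (t * gcd a n) % n      ∎)
    where open ≡-Reasoning

  prime∣prime⇒≡ : Prime p → Prime q → p ∣ q → p ≡ q
  prime∣prime⇒≡ p-prime q-prime p∣q with prime⇒irreducible q-prime p∣q
  ... | inj₁ refl = ⊥-elim (¬prime[1] p-prime)
  ... | inj₂ p≡q = p≡q

  prime∤⇒coprime : Prime p → ¬ p ∣ d → Coprime d p
  prime∤⇒coprime p-prime p∤d (i∣d , i∣p) with prime⇒irreducible p-prime i∣p
  ... | inj₁ i≡1 = i≡1
  ... | inj₂ refl = ⊥-elim (p∤d i∣d)

  ∣p^m⇒≡p^i : Prime p → ∀ m → d ∣ p ^ m → ∃ λ i → d ≡ p ^ i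
  ∣p^m⇒≡p^i p-prime zero d∣1 = 0 , ∣1⇒≡1 d∣1
  ∣p^m⇒≡p^i {p} {d} p-prime (suc m) d∣p^1+m with p ∣? d
  ... | no p∤d = ∣p^m⇒≡p^i p-prime m (coprime-divisor (prime∤⇒coprime p-prime p∤d) d∣p^1+m)
  ... | yes (divides e refl) =
    let instance _ = prime⇒nonZero p-prime
        e∣p^m = *-cancelˡ-∣ p (subst (_∣ p ^ suc m) (*-comm e p) d∣p^1+m)
        i , e≡p^i = ∣p^m⇒≡p^i p-prime m e∣p^m
    in suc i , trans (*-comm e p) (cong (p *_) e≡p^i)

  ^-monoʳ-∣ : ∀ p {i j} → i ≤ j → p ^ i ∣ p ^ j
  ^-monoʳ-∣ p {i} {j} i≤j = divides (p ^ (j ∸ i)) (begin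
    p ^ j                ≡⟨ cong (p ^_) (m∸n+n≡m i≤j) ⟨
    p ^ (j ∸ i + i)      ≡⟨ ^-distribˡ-+-* p (j ∸ i) i ⟩
    p ^ (j ∸ i) * p ^ i  ∎)
    where open ≡-Reasoning

  DivisorChain : ℕ → Set
  DivisorChain n = ∀ {a b} → a ∣ n → b ∣ n → a ∣ b ⊎ b ∣ a

  prime-power⇒divisor-chain : Prime p → ∀ m → DivisorChain (p ^ m)
  prime-power⇒divisor-chain {p} p-prime m a∣p^m b∣p^m
    with i , refl ← ∣p^m⇒≡p^i p-prime m a∣p^m
       | j , refl ← ∣p^m⇒≡p^i p-prime m b∣p^m
    with ≤-total i j
  ... | inj₁ i≤j = inj₁ (^-monoʳ-∣ p i≤j)
  ... | inj₂ j≤i = inj₂ (^-monoʳ-∣ p j≤i)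

  product-≡-^ : ∀ {xs : List ℕ} → All (_≡ q) xs → product xs ≡ q ^ length xs
  product-≡-^ [] = refl
  product-≡-^ {q} (refl ∷ xs≡q) = cong (q *_) (product-≡-^ xs≡q)

  divisor-chain⇒prime-divisors-≡ : DivisorChain n → Prime p → Prime q → p ∣ n → q ∣ n → p ≡ q
  divisor-chain⇒prime-divisors-≡ chain p-prime q-prime p∣n q∣n with chain p∣n q∣n
  ... | inj₁ p∣q = prime∣prime⇒≡ p-prime q-prime p∣q
  ... | inj₂ q∣p = sym (prime∣prime⇒≡ q-prime p-prime q∣p)

  divisor-chain⇒prime-power : .{{_ : NonZero n}} → DivisorChain n →
    ∃ λ p → Prime p × ∃ λ k → n ≡ p ^ k
  divisor-chain⇒prime-power {n} chain with factorise n
  ... | record { factors = [] ; isFactorisation = n≡1 } = 2 , prime[2] , 0 , n≡1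
  ... | record { factors = q ∷ qs ; isFactorisation = n≡∏ ; factorsPrime = primes@(q-prime ∷ _) } =
    q , q-prime , length (q ∷ qs) , trans n≡∏ (product-≡-^ (All.tabulate factor≡q))
    where
    factor∣n : ∀ {x} → x ∈ q ∷ qs → x ∣ n
    factor∣n x∈ = subst (_ ∣_) (sym n≡∏) (∈⇒∣product x∈)
    factor≡q : ∀ {x} → x ∈ q ∷ qs → x ≡ q
    factor≡q x∈ =
      divisor-chain⇒prime-divisors-≡ chain (All.lookup primes x∈) q-prime (factor∣n x∈) (factor∣n (here refl))

open Arithmetic

module PowerLaws {c ℓ} (G : Group c ℓ) where
  open Group G
  open import Algebra.Properties.Monoid.Mult monoid using (×-homo-1; ×-homo-+; ×-assocˡ; ×-congʳ; ×-congˡ)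
  open import Relation.Binary.Reasoning.Setoid setoid

  private
    variable
      x y z x′ y′ : Carrier
      a b d r s : ℕ

  infixr 8 _^_
  infix 4 _∈⟨_⟩ _∈⁺⟨_⟩

  _^_ : Carrier → ℕ → Carrier
  x ^ k = pow G k x

  ^-1 : ∀ x → x ^ 1 ≈ x
  ^-1 = ×-homo-1

  ^-+ : ∀ x a b → x ^ (a + b) ≈ x ^ a ∙ x ^ b
  ^-+ = ×-homo-+

  ^-*-assoc : ∀ x a b → (x ^ a) ^ b ≈ x ^ (a * b)
  ^-*-assoc x a b = trans (×-assocˡ x b a) (×-congˡ (*-comm b a))

  ^-cong : ∀ k → x ≈ y → x ^ k ≈ y ^ k
  ^-cong k = ×-congʳ k

  ε^≈ε : ∀ k → ε ^ k ≈ ε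
  ε^≈ε zero = refl
  ε^≈ε (suc k) = trans (identityˡ _) (ε^≈ε k)

  ^-≈⇒^-∸≈ε : r ≤ s → x ^ r ≈ x ^ s → x ^ (s ∸ r) ≈ ε
  ^-≈⇒^-∸≈ε {r} {s} {x} r≤s x^r≈x^s = identityˡ-unique _ _ (begin
    x ^ (s ∸ r) ∙ x ^ r  ≈⟨ ^-+ x (s ∸ r) r ⟨
    x ^ (s ∸ r + r)      ≡⟨ ≡.cong (x ^_) (m∸n+n≡m r≤s) ⟩
    x ^ s                ≈⟨ x^r≈x^s ⟨
    x ^ r                ∎)
    where open import Algebra.Properties.Group G using (identityˡ-unique)

  ^-% : .{{_ : NonZero d}} → x ^ d ≈ ε → ∀ a → x ^ a ≈ x ^ (a % d)
  ^-% {d} {x} x^d≈ε a = begin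
    x ^ a                              ≡⟨ ≡.cong (x ^_) (m≡m%n+[m/n]*n a d) ⟩
    x ^ (a % d + a / d * d)            ≈⟨ ^-+ x (a % d) _ ⟩
    x ^ (a % d) ∙ x ^ (a / d * d)      ≡⟨ ≡.cong (λ k → x ^ (a % d) ∙ x ^ k) (*-comm (a / d) d) ⟩
    x ^ (a % d) ∙ x ^ (d * (a / d))    ≈⟨ ∙-congˡ (^-*-assoc x d (a / d)) ⟨
    x ^ (a % d) ∙ (x ^ d) ^ (a / d)    ≈⟨ ∙-congˡ (trans (^-cong (a / d) x^d≈ε) (ε^≈ε (a / d))) ⟩
    x ^ (a % d) ∙ ε                    ≈⟨ identityʳ _ ⟩
    x ^ (a % d)                        ∎

  %≡⇒^≈ : .{{_ : NonZero d}} → x ^ d ≈ ε → a % d ≡ b % d → x ^ a ≈ x ^ b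
  %≡⇒^≈ {d} {x} {a} {b} x^d≈ε a≡b = begin
    x ^ a        ≈⟨ ^-% x^d≈ε a ⟩
    x ^ (a % d)  ≡⟨ ≡.cong (x ^_) a≡b ⟩
    x ^ (b % d)  ≈⟨ ^-% x^d≈ε b ⟨
    x ^ b        ∎

  _∈⟨_⟩ : Carrier → Carrier → Set ℓ
  y ∈⟨ x ⟩ = ∃ λ k → y ≈ x ^ k

  _∈⁺⟨_⟩ : Carrier → Carrier → Set ℓ
  y ∈⁺⟨ x ⟩ = ∃ λ k → k ≥ 1 × y ≈ x ^ k

  ∈⟨⟩-refl : x ∈⟨ x ⟩
  ∈⟨⟩-refl {x} = 1 , sym (^-1 x)

  ∈⟨⟩-trans : z ∈⟨ y ⟩ → y ∈⟨ x ⟩ → z ∈⟨ x ⟩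
  ∈⟨⟩-trans {z} {y} {x} (k , z≈y^k) (l , y≈x^l) = l * k , (begin
    z            ≈⟨ z≈y^k ⟩
    y ^ k        ≈⟨ ^-cong k y≈x^l ⟩
    (x ^ l) ^ k  ≈⟨ ^-*-assoc x l k ⟩
    x ^ (l * k)  ∎)

  ∈⟨⟩-respˡ-≈ : y ≈ y′ → y′ ∈⟨ x ⟩ → y ∈⟨ x ⟩
  ∈⟨⟩-respˡ-≈ y≈y′ (k , y′≈x^k) = k , trans y≈y′ y′≈x^k

  ∈⁺⟨⟩⇒∈⟨⟩ : y ∈⁺⟨ x ⟩ → y ∈⟨ x ⟩
  ∈⁺⟨⟩⇒∈⟨⟩ (k , _ , y≈x^k) = k , y≈x^k

  ∈⁺⟨⟩-resp-≈ : x ≈ x′ → y ≈ y′ → y ∈⁺⟨ x ⟩ → y′ ∈⁺⟨ x′ ⟩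
  ∈⁺⟨⟩-resp-≈ x≈x′ y≈y′ (k , k≥1 , y≈x^k) = k , k≥1 , trans (sym y≈y′) (trans y≈x^k (^-cong k x≈x′))

module _ {a ℓ r} {A : Set a} (_≈_ : A → A → Set ℓ) (R : A → A → Set r) where

  Universal : A → Set (a ⊔ ℓ ⊔ r)
  Universal x = ∀ {y} → ¬ x ≈ y → R x y

  Complete : Set (a ⊔ ℓ ⊔ r)
  Complete = ∀ {x y} → ¬ x ≈ y → R x y

module PowerGraph {c ℓ} (G : Group c ℓ) where
  open Group G
  open PowerLaws G

  complete⇒common-generator : Decidable _≈_ → Complete _≈_ (PowerAdj G) →
    ∀ {m} (xs : Fin m → Carrier) → ∃ λ g → ∀ i → xs i ∈⟨ g ⟩
  complete⇒common-generator _≟_ complete {zero} xs = ε , λ ()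
  complete⇒common-generator _≟_ complete {suc m} xs
    with g , generates ← complete⇒common-generator _≟_ complete (λ i → xs (Fin.suc i))
    with xs Fin.zero ≟ g
  ... | yes x≈g = g , λ { Fin.zero → 1 , trans x≈g (sym (^-1 g)) ; (Fin.suc i) → generates i }
  ... | no x≉g with proj₂ (complete x≉g)
  ...   | inj₁ g∈⁺⟨x⟩ = xs Fin.zero , λ
          { Fin.zero → ∈⟨⟩-refl ; (Fin.suc i) → ∈⟨⟩-trans (generates i) (∈⁺⟨⟩⇒∈⟨⟩ g∈⁺⟨x⟩) }
  ...   | inj₂ x∈⁺⟨g⟩ = g , λ { Fin.zero → ∈⁺⟨⟩⇒∈⟨⟩ x∈⁺⟨g⟩ ; (Fin.suc i) → generates i }

module FiniteGroup {c ℓ} (G : Group c ℓ) {n} (ord : HasOrder G n) where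
  open Group G
  open HasOrder ord
  open PowerLaws G

  private
    variable
      x y : Carrier

  index : Carrier → Fin n
  index x = proj₁ (enum-surj x)

  ≈-enum-index : ∀ x → x ≈ enum (index x)
  ≈-enum-index x = proj₂ (enum-surj x)

  index-injective : index x ≡ index y → x ≈ y
  index-injective {x} {y} eq = trans (≈-enum-index x) (trans (reflexive (≡.cong enum eq)) (sym (≈-enum-index y)))

  infix 4 _≟_
  _≟_ : Decidable _≈_
  x ≟ y with index x Fin.≟ index y
  ... | yes eq = yes (index-injective eq)
  ... | no ne = no λ x≈y → ne (enum-inj _ _ (trans (sym (≈-enum-index x)) (trans x≈y (≈-enum-index y))))

  instance
    order-nonZero : NonZero n
    order-nonZero = >-nonZero (≤-<-trans z≤n (toℕ<n (index ε)))

  exponent : ∀ x → ∃ λ d → d ≥ 1 × d ≤ n × x ^ d ≈ ε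
  exponent x
    with i , j , i<j , eq ← pigeonhole (n<1+n n) (λ (i : Fin (suc n)) → index (x ^ toℕ i)) =
    toℕ j ∸ toℕ i , m<n⇒0<n∸m i<j , ≤-trans (m∸n≤m (toℕ j) (toℕ i)) (s≤s⁻¹ (toℕ<n j)) ,
    ^-≈⇒^-∸≈ε (<⇒≤ i<j) (index-injective eq)

  ε-universal : Universal _≈_ (PowerAdj G) ε
  ε-universal {y} ε≉y with d , d≥1 , _ , y^d≈ε ← exponent y = ε≉y , inj₂ (d , d≥1 , sym y^d≈ε)

  complete⇒cyclic : Complete _≈_ (PowerAdj G) → IsCyclic G
  complete⇒cyclic complete with g , generates ← PowerGraph.complete⇒common-generator G _≟_ complete enum =
    g , λ x → ∈⟨⟩-respˡ-≈ (≈-enum-index x) (generates (index x))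

module CyclicGroup {c ℓ} (G : Group c ℓ) {n} (ord : HasOrder G n)
                   (g : Group.Carrier G) (generates : ∀ x → PowerLaws._∈⟨_⟩ G x g) where
  open Group G
  open HasOrder ord
  open PowerLaws G
  open FiniteGroup G ord
  open import Relation.Binary.Reasoning.Setoid setoid

  private
    variable
      a b d r s : ℕ

  -- Reducing the exponents of the generator modulo d maps G injectively into Fin d.
  n≤exponent : d ≥ 1 → g ^ d ≈ ε → n ≤ d
  n≤exponent {d} d≥1 g^d≈ε = injective⇒≤ residue-injective
    where
    instance _ = >-nonZero d≥1
    log : Fin n → ℕ
    log i = proj₁ (generates (enum i))
    residue : Fin n → Fin d
    residue i = fromℕ< (m%n<n (log i) d)
    residue-injective : ∀ {i j} → residue i ≡ residue j → i ≡ j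
    residue-injective {i} {j} eq = enum-inj i j (begin
      enum i       ≈⟨ proj₂ (generates (enum i)) ⟩
      g ^ log i    ≈⟨ %≡⇒^≈ g^d≈ε (fromℕ<-injective _ _ _ _ eq) ⟩
      g ^ log j    ≈⟨ proj₂ (generates (enum j)) ⟨
      enum j       ∎)

  g^n≈ε : g ^ n ≈ ε
  g^n≈ε with d , d≥1 , d≤n , g^d≈ε ← exponent g =
    ≡.subst (λ k → g ^ k ≈ ε) (≤-antisym d≤n (n≤exponent d≥1 g^d≈ε)) g^d≈ε

  ^-injective-below-n : r < s → s < n → ¬ g ^ r ≈ g ^ s
  ^-injective-below-n {r} {s} r<s s<n g^r≈g^s = <⇒≱ (≤-<-trans (m∸n≤m s r) s<n)
    (n≤exponent (m<n⇒0<n∸m r<s) (^-≈⇒^-∸≈ε (<⇒≤ r<s) g^r≈g^s))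

  ^≈⇒%≡ : g ^ a ≈ g ^ b → a % n ≡ b % n
  ^≈⇒%≡ {a} {b} g^a≈g^b with <-cmp (a % n) (b % n)
  ... | tri≈ _ eq _ = eq
  ... | tri< lt _ _ = ⊥-elim (^-injective-below-n lt (m%n<n b n) (begin
    g ^ (a % n)  ≈⟨ ^-% g^n≈ε a ⟨
    g ^ a        ≈⟨ g^a≈g^b ⟩
    g ^ b        ≈⟨ ^-% g^n≈ε b ⟩
    g ^ (b % n)  ∎))
  ... | tri> _ _ gt = ⊥-elim (^-injective-below-n gt (m%n<n a n) (begin
    g ^ (b % n)  ≈⟨ ^-% g^n≈ε b ⟨
    g ^ b        ≈⟨ g^a≈g^b ⟨
    g ^ a        ≈⟨ ^-% g^n≈ε a ⟩
    g ^ (a % n)  ∎))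

  ^∈⟨^⟩⇒∣ : a ∣ n → g ^ b ∈⟨ g ^ a ⟩ → a ∣ b
  ^∈⟨^⟩⇒∣ {a} a∣n (k , g^b≈[g^a]^k) =
    ∣-resp-%≡ a∣n (^≈⇒%≡ (trans (sym (^-*-assoc g a k)) (sym g^b≈[g^a]^k))) (m∣m*n k)

  gcd∣⇒^∈⁺⟨^⟩ : ∀ a b → gcd a n ∣ b → g ^ b ∈⁺⟨ g ^ a ⟩
  gcd∣⇒^∈⁺⟨^⟩ a b gcd∣b with k , k≥1 , ak≡b ← gcd∣⇒%-solvable {n = n} {a = a} {b = b} gcd∣b =
    k , k≥1 , trans (%≡⇒^≈ {n} {g} {b} {a * k} g^n≈ε (≡.sym ak≡b)) (sym (^-*-assoc g a k))

  divisor-chain⇒complete : DivisorChain n → Complete _≈_ (PowerAdj G)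
  divisor-chain⇒complete chain {x} {y} x≉y
    with a , x≈g^a ← generates x | b , y≈g^b ← generates y
    with chain (gcd[m,n]∣n a n) (gcd[m,n]∣n b n)
  ... | inj₁ gcd[a,n]∣gcd[b,n] = x≉y , inj₁ (∈⁺⟨⟩-resp-≈ (sym x≈g^a) (sym y≈g^b)
          (gcd∣⇒^∈⁺⟨^⟩ a b (∣-trans gcd[a,n]∣gcd[b,n] (gcd[m,n]∣m b n))))
  ... | inj₂ gcd[b,n]∣gcd[a,n] = x≉y , inj₂ (∈⁺⟨⟩-resp-≈ (sym y≈g^b) (sym x≈g^a)
          (gcd∣⇒^∈⁺⟨^⟩ b a (∣-trans gcd[b,n]∣gcd[a,n] (gcd[m,n]∣m a n))))

  complete⇒divisor-chain : Complete _≈_ (PowerAdj G) → DivisorChain n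
  complete⇒divisor-chain complete {a} {b} a∣n b∣n with g ^ a ≟ g ^ b
  ... | yes g^a≈g^b = inj₁ (^∈⟨^⟩⇒∣ a∣n (∈⟨⟩-respˡ-≈ (sym g^a≈g^b) ∈⟨⟩-refl))
  ... | no g^a≉g^b with proj₂ (complete g^a≉g^b)
  ...   | inj₁ g^b∈⁺⟨g^a⟩ = inj₁ (^∈⟨^⟩⇒∣ a∣n (∈⁺⟨⟩⇒∈⟨⟩ g^b∈⁺⟨g^a⟩))
  ...   | inj₂ g^a∈⁺⟨g^b⟩ = inj₂ (^∈⟨^⟩⇒∣ b∣n (∈⁺⟨⟩⇒∈⟨⟩ g^a∈⁺⟨g^b⟩))

module _ {c ℓ} {G : Group c ℓ} {n} (ord : HasOrder G n) where
  open Group G using (_≈_)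
  open FiniteGroup G ord using (complete⇒cyclic; order-nonZero)

  complete⇒cyclic-prime-power : Complete _≈_ (PowerAdj G) → IsCyclicPGroup G n
  complete⇒cyclic-prime-power complete with g , generates ← complete⇒cyclic complete =
    divisor-chain⇒prime-power (CyclicGroup.complete⇒divisor-chain G ord g generates complete) , g , generates

  cyclic-prime-power⇒complete : IsCyclicPGroup G n → Complete _≈_ (PowerAdj G)
  cyclic-prime-power⇒complete ((p , p-prime , m , n≡p^m) , g , generates) =
    CyclicGroup.divisor-chain⇒complete G ord g generates
      (≡.subst DivisorChain (≡.sym n≡p^m) (prime-power⇒divisor-chain p-prime m))

module _ {a b ℓa ℓb r s} {A : Set a} {B : Set b}
         {_≈A_ : A → A → Set ℓa} {R : A → A → Set r}
         {_≈B_ : B → B → Set ℓb} {S : B → B → Set s}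
         (iso : GraphIso _≈A_ R _≈B_ S) where
  open GraphIso iso

  GraphIso-reflects-complete : Complete _≈B_ S → Complete _≈A_ R
  GraphIso-reflects-complete complete x≉y = adj-from (complete (λ fx≈fy → x≉y (f-inj fx≈fy)))

  GraphIso-preserves-universal : IsEquivalence _≈B_ → (∀ {u v w} → v ≈B w → S u v → S u w) →
    ∀ {x} → Universal _≈A_ R x → Universal _≈B_ S (f x)
  GraphIso-preserves-universal ≈B-equiv S-respʳ universal {y} fx≉y
    with y′ , y≈fy′ ← f-surj y =
    S-respʳ (sym y≈fy′) (adj-to (universal λ x≈y′ → fx≉y (trans (f-cong x≈y′) (sym y≈fy′))))
    where open IsEquivalence ≈B-equiv

module Cayley {c ℓ} (H : Group c ℓ) where
  open Group H
  open import Algebra.Properties.Group H using (\\-leftDividesˡ; \\-leftDividesʳ; identityʳ-unique; ⁻¹-injective; ε⁻¹≈ε)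

  \\≈ε⇒≈ : ∀ {x y} → x \\ y ≈ ε → x ≈ y
  \\≈ε⇒≈ {x} {y} x\\y≈ε = sym (trans (sym (\\-leftDividesˡ x y)) (trans (∙-congˡ x\\y≈ε) (identityʳ x)))

  module _ {ℓc} {C : Carrier → Set ℓc} (isCayleySet : CayleySet H C) where
    open CayleySet isCayleySet

    CayleyAdj-respʳ : ∀ {u v w} → v ≈ w → CayleyAdj H C u v → CayleyAdj H C u w
    CayleyAdj-respʳ v≈w (u≉v , C[u\\v]) = (λ u≈w → u≉v (trans u≈w (sym v≈w))) , respects (∙-congˡ v≈w) C[u\\v]

    universal⇒complete : ∀ {h} → Universal _≈_ (CayleyAdj H C) h → Complete _≈_ (CayleyAdj H C)
    universal⇒complete {h} universal {x} {y} x≉y = x≉y , nonidentity∈C (λ x\\y≈ε → x≉y (\\≈ε⇒≈ x\\y≈ε))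
      where
      -- h is adjacent to h ∙ z, and h ⁻¹ ∙ (h ∙ z) ≈ z.
      nonidentity∈C : ∀ {z} → ¬ z ≈ ε → C z
      nonidentity∈C {z} z≉ε = respects (\\-leftDividesʳ h z)
        (proj₂ (universal λ h≈hz → z≉ε (identityʳ-unique h z (sym h≈hz))))

  NonIdentity : Carrier → Set ℓ
  NonIdentity z = ¬ z ≈ ε

  nonIdentity-cayleySet : CayleySet H NonIdentity
  nonIdentity-cayleySet = record
    { respects    = λ x≈y x≉ε y≈ε → x≉ε (trans x≈y y≈ε)
    ; inv-closed  = λ x≉ε x⁻¹≈ε → x≉ε (⁻¹-injective (trans x⁻¹≈ε (sym ε⁻¹≈ε)))
    ; no-identity = λ ε≉ε → ε≉ε refl
    }

  complete≅cayley-nonIdentity : ∀ {r} {R : Carrier → Carrier → Set r} → (∀ {x y} → R x y → ¬ x ≈ y) →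
    Complete _≈_ R → GraphIso _≈_ R _≈_ (CayleyAdj H NonIdentity)
  complete≅cayley-nonIdentity irreflexive complete = record
    { f        = λ x → x
    ; f-cong   = λ x≈y → x≈y
    ; f-inj    = λ x≈y → x≈y
    ; f-surj   = λ y → y , refl
    ; adj-to   = λ Rxy → irreflexive Rxy , λ x\\y≈ε → irreflexive Rxy (\\≈ε⇒≈ x\\y≈ε)
    ; adj-from = λ (x≉y , _) → complete x≉y
    }

theorem2p1 : ∀ {c ℓ : Level} (G : Group c ℓ) (n : ℕ) → HasOrder G n →
  (PowerGraphIsCayley G → IsCyclicPGroup G n) × (IsCyclicPGroup G n → PowerGraphIsCayley G)
theorem2p1 G n ord = cayley⇒cyclic-prime-power , cyclic-prime-power⇒cayley
  where
  cayley⇒cyclic-prime-power : PowerGraphIsCayley G → IsCyclicPGroup G n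
  cayley⇒cyclic-prime-power (H , C , isCayleySet , iso) =
    complete⇒cyclic-prime-power ord
      (GraphIso-reflects-complete iso (Cayley.universal⇒complete H isCayleySet
        (GraphIso-preserves-universal iso (Group.isEquivalence H) (Cayley.CayleyAdj-respʳ H isCayleySet)
          (FiniteGroup.ε-universal G ord))))

  cyclic-prime-power⇒cayley : IsCyclicPGroup G n → PowerGraphIsCayley G
  cyclic-prime-power⇒cayley cyclic-p =
    G , NonIdentity , nonIdentity-cayleySet , complete≅cayley-nonIdentity proj₁ (cyclic-prime-power⇒complete ord cyclic-p)
    where open Cayley G
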